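{- Let $T$ be a finite Church-Rosser Thue system over $\Sigma$ and let $u_1,\dots,u_n$ be strings, irreducible modulo $T$, lying in $L$, such that $L=[u_1]_T\cup\dots\cup[u_n]_T$. Let $Q=\max_{(\ell,r)\in T}|\ell|$ and $R=\max_{1\le j\le n}|u_j|_{\mathrm{neg}}$. For every positive integer $k$, if $y$ is a positive string of length $QR+k$, then for each $1\le i\le n$ the strings $y$ and $\mathrm{irr}_T(u_iy)$ agree on their rightmost $k$ letters.
   Context: $\Sigma=\{a,b,\overline{a},\overline{b}\}$; $a,b$ are positive letters and $\overline{a},\overline{b}$ negative letters; $|x|_{\mathrm{neg}}$ is the number of occurrences of negative letters in $x$; a string is positive if all its letters are positive. $\lambda$ is the empty string. $S$ is the Thue system with rules $(a\overline{a},\lambda),(\overline{a}a,\lambda),(a\overline{b},\lambda),(\overline{b}a,\lambda),(b\overline{a},\lambda),(\overline{a}b,\lambda),(b\overline{b},\lambda),(\overline{b}b,\lambda),(a,b),(b,a),(\overline{a},\overline{b}),(\overline{b},\overline{a})$, and $L=[\lambda]_S$, the set of strings with equally many positive as negative letters. For a Thue system $T$, rules are written $(\ell,r)$ with $|\ell|\ge|r|$; $x\leftrightarrow_T y$ if $x=tuv$, $y=twv$ with $(u,w)$ or $(w,u)\in T$; $\overset{*}{\leftrightarrow}_T$ its reflexive-transitive closure; $[x]_T$ the class of $x$; $x\to_T y$ means $x\leftrightarrow_T y$ with $|x|>|y|$; a string is irreducible modulo $T$ if no $\to_T$ step applies to it. $T$ is Church-Rosser if $x\overset{*}{\leftrightarrow}_T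 y$ implies a common $z$ with $x\overset{*}{\to}_T z$, $y\overset{*}{\to}_T z$; in that case every string in $[x]_T$ reduces to the same irreducible string, denoted $\mathrm{irr}_T(x)$. -}

module Defs where

open import Data.Nat using (ℕ; zero; suc; _+_; _*_; _⊔_; _≤_; _<_)
open import Data.List using (List; []; _∷_; _++_; length; foldr; map; filter)
open import Data.List.Membership.Propositional using (_∈_)
open import Data.List.Relation.Unary.All using (All)
open import Data.Product using (_×_; _,_; ∃; ∃-syntax; proj₁)
open import Relation.Binary.PropositionalEquality using (_≡_)
open import Relation.Binary.Construct.Closure.ReflexiveTransitive using (Star)
open import Relation.Nullary using (¬_)

data Letter : Set where
  a b a̅ b̅ : Letter

Word : Set
Word = List Letter

data PositiveLetter : Letter → Set where
  pos-a : PositiveLetter a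
  pos-b : PositiveLetter b

isNeg : Letter → ℕ
isNeg a = 0
isNeg b = 0
isNeg a̅ = 1
isNeg b̅ = 1

negCount : Word → ℕ
negCount [] = 0
negCount (c ∷ x) = isNeg c + negCount x

PositiveWord : Word → Set
PositiveWord = All PositiveLetter

ThueSystem : Set
ThueSystem = List (Word × Word)

data Step (T : ThueSystem) : Word → Word → Set where
  fwd : ∀ t v {u w} → (u , w) ∈ T → Step T (t ++ u ++ v) (t ++ w ++ v)
  bwd : ∀ t v {u w} → (w , u) ∈ T → Step T (t ++ u ++ v) (t ++ w ++ v)

Congruent : ThueSystem → Word → Word → Set
Congruent T = Star (Step T)

InClass : ThueSystem → Word → Word → Set
InClass T x y = Congruent T x y

Reduces1 : ThueSystem → Word → Word → Set
Reduces1 T x y = Step T x y × length y < length x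

Reduces : ThueSystem → Word → Word → Set
Reduces T = Star (Reduces1 T)

Irreducible : ThueSystem → Word → Set
Irreducible T x = ∀ y → ¬ Reduces1 T x y

ChurchRosser : ThueSystem → Set
ChurchRosser T = ∀ x y → Congruent T x y → ∃[ z ] (Reduces T x z × Reduces T y z)

LengthOrdered : ThueSystem → Set
LengthOrdered T = ∀ {ℓ r} → (ℓ , r) ∈ T → length r ≤ length ℓ

S : ThueSystem
S = (a ∷ a̅ ∷ [] , []) ∷ (a̅ ∷ a ∷ [] , []) ∷ (a ∷ b̅ ∷ [] , []) ∷ (b̅ ∷ a ∷ [] , [])
  ∷ (b ∷ a̅ ∷ [] , []) ∷ (a̅ ∷ b ∷ [] , []) ∷ (b ∷ b̅ ∷ [] , []) ∷ (b̅ ∷ b ∷ [] , [])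
  ∷ (a ∷ [] , b ∷ []) ∷ (b ∷ [] , a ∷ []) ∷ (a̅ ∷ [] , b̅ ∷ []) ∷ (b̅ ∷ [] , a̅ ∷ []) ∷ []

InL : Word → Set
InL x = InClass S [] x

Q : ThueSystem → ℕ
Q T = foldr (λ rule m → length (proj₁ rule) ⊔ m) 0 T

R : List Word → ℕ
R us = foldr (λ u m → negCount u ⊔ m) 0 us

AgreeRight : ℕ → Word → Word → Set
AgreeRight k y z = ∃[ w ] (length w ≡ k × ∃[ p ] (y ≡ p ++ w) × ∃[ q ] (z ≡ q ++ w))

-- Every length-reducing rule (ℓ, r) of T removes negative letters: rewriting ℓ to r inside
-- inverse ℓ ++ ℓ ∈ L stays in L, because T-classes of L-words lie in L, so ℓ and r have the same
-- balance (#positive − #negative); being shorter, r has fewer negative letters.  Hence a reduction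
-- of u y to its normal form has at most |u|_neg ≤ R steps.  No redex lies inside a positive word, so
-- each step cuts at most Q letters off the left of the surviving suffix of y, and at least
-- |y| − QR = k letters of y survive.
module Submission where

open import Defs
open import Data.Empty using (⊥-elim)
open import Data.Integer as ℤ using (ℤ; +_; -[1+_]; +≤+)
import Data.Integer.Properties as ℤₚ
open import Algebra.Properties.AbelianGroup ℤₚ.+-0-abelianGroup using (∙-cancelˡ; ∙-cancelʳ)
open import Algebra.Properties.CommutativeSemigroup ℤₚ.+-commutativeSemigroup using (interchange)
open import Data.List using (List; []; _∷_; _++_; _∷ʳ_; length; foldr; take; drop)
import Data.List.Properties as List
open import Data.List.Membership.Propositional using (_∈_)
open import Data.List.Relation.Unary.All using (All; []; _∷_; lookup)
open import Data.List.Relation.Unary.All.Properties using (++⁻ˡ; ++⁻ʳ)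
open import Data.List.Relation.Unary.Any as Any using (Any; here; there)
open import Data.Nat using (ℕ; suc; _+_; _*_; _∸_; _⊔_; _≤_; _<_)
open import Data.Nat.Properties
open import Data.Product using (_×_; _,_; ∃-syntax; proj₁; proj₂)
open import Data.Sum using (_⊎_; inj₁; inj₂)
open import Relation.Binary.Construct.Closure.ReflexiveTransitive using (ε; _◅_; _◅◅_)
open import Relation.Binary.PropositionalEquality
  using (_≡_; refl; sym; trans; cong; cong₂; subst; subst₂; module ≡-Reasoning)

++-overlap : ∀ {A : Set} (ws xs ys zs : List A) → ws ++ xs ≡ ys ++ zs →
  (∃[ e ] (ws ≡ ys ++ e × zs ≡ e ++ xs)) ⊎ (∃[ e ] (ys ≡ ws ++ e × xs ≡ e ++ zs))
++-overlap []       xs ys       zs eq = inj₂ (ys , refl , eq)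
++-overlap (w ∷ ws) xs []       zs eq = inj₁ (w ∷ ws , refl , sym eq)
++-overlap (w ∷ ws) xs (y ∷ ys) zs eq with List.∷-injective eq
... | refl , eq′ with ++-overlap ws xs ys zs eq′
...   | inj₁ (e , ws≡ , zs≡) = inj₁ (e , cong (w ∷_) ws≡ , zs≡)
...   | inj₂ (e , ys≡ , xs≡) = inj₂ (e , cong (w ∷_) ys≡ , xs≡)

foldr-⊔-bound : ∀ {A : Set} (f : A → ℕ) {x xs} → x ∈ xs → f x ≤ foldr (λ y m → f y ⊔ m) 0 xs
foldr-⊔-bound f {xs = x ∷ xs} (here refl) = m≤m⊔n (f x) _
foldr-⊔-bound f {xs = y ∷ xs} (there x∈xs) = ≤-trans (foldr-⊔-bound f x∈xs) (m≤n⊔m (f y) _)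

shed-budget : ∀ q {m n k e v} → m < n → q * n + k ≤ e + v → e ≤ q → q * m + k ≤ v
shed-budget q {m} {n} {k} {e} {v} m<n budget e≤q = +-cancelˡ-≤ q _ _ (begin
  q + (q * m + k)  ≡⟨ +-assoc q _ k ⟨
  q + q * m + k    ≡⟨ cong (_+ k) (*-suc q m) ⟨
  q * suc m + k    ≤⟨ +-monoˡ-≤ k (*-monoʳ-≤ q m<n) ⟩
  q * n + k        ≤⟨ budget ⟩
  e + v            ≤⟨ +-monoˡ-≤ v e≤q ⟩
  q + v            ∎)
  where open ≤-Reasoning

record SharedSuffix (n : ℕ) (x y : Word) : Set where
  constructor shared
  field
    prefix₁ prefix₂ suffix : Word
    x≡ : x ≡ prefix₁ ++ suffix
    y≡ : y ≡ prefix₂ ++ suffix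
    long : n ≤ length suffix

SharedSuffix-weaken : ∀ {m n x y} → m ≤ n → SharedSuffix n x y → SharedSuffix m x y
SharedSuffix-weaken m≤n (shared p q s x≡ y≡ long) = shared p q s x≡ y≡ (≤-trans m≤n long)

SharedSuffix⇒AgreeRight : ∀ {k x y} → SharedSuffix k x y → AgreeRight k x y
SharedSuffix⇒AgreeRight {k} (shared p q s x≡ y≡ k≤∣s∣) =
  drop n s , ∣drop∣≡k , (p ++ take n s) , split p x≡ , (q ++ take n s) , split q y≡
  where
  n : ℕ
  n = length s ∸ k
  ∣drop∣≡k : length (drop n s) ≡ k
  ∣drop∣≡k = trans (List.length-drop n s) (m∸[m∸n]≡n k≤∣s∣)
  split : ∀ r {w} → w ≡ r ++ s → w ≡ (r ++ take n s) ++ drop n s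
  split r w≡ = trans w≡ (trans (cong (r ++_) (sym (List.take++drop≡id n s))) (sym (List.++-assoc r _ _)))

module Additive (f : Word → ℕ) (f-++ : ∀ x y → f (x ++ y) ≡ f x + f y) where

  infix-expand : ∀ t u v → f (t ++ u ++ v) ≡ f t + (f u + f v)
  infix-expand t u v = trans (f-++ t (u ++ v)) (cong (λ n → f t + n) (f-++ u v))

  infix-mono-< : ∀ t v {u w} → f u < f w → f (t ++ u ++ v) < f (t ++ w ++ v)
  infix-mono-< t v {u} {w} fu<fw = subst₂ _<_ (sym (infix-expand t u v)) (sym (infix-expand t w v))
    (+-monoʳ-< (f t) (+-monoˡ-< (f v) fu<fw))

  infix-cancel-< : ∀ t v {u w} → f (t ++ u ++ v) < f (t ++ w ++ v) → f u < f w
  infix-cancel-< t v {u} {w} lt = +-cancelʳ-< (f v) (f u) (f w) (+-cancelˡ-< (f t) _ _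
    (subst₂ _<_ (infix-expand t u v) (infix-expand t w v) lt))

negCount-++ : ∀ x y → negCount (x ++ y) ≡ negCount x + negCount y
negCount-++ []      y = refl
negCount-++ (c ∷ x) y = trans (cong (λ n → isNeg c + n) (negCount-++ x y)) (sym (+-assoc (isNeg c) _ _))

open Additive length (λ x y → List.length-++ x) using () renaming (infix-cancel-< to length-infix-cancel-<)
open Additive negCount negCount-++ using () renaming (infix-mono-< to negCount-infix-mono-<)

negCount-positive : ∀ {w} → PositiveWord w → negCount w ≡ 0
negCount-positive []           = refl
negCount-positive (pos-a ∷ pw) = negCount-positive pw
negCount-positive (pos-b ∷ pw) = negCount-positive pw

sign : Letter → ℤ
sign a = + 1
sign b = + 1
sign a̅ = -[1+ 0 ]
sign b̅ = -[1+ 0 ]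

balance : Word → ℤ
balance []      = + 0
balance (c ∷ w) = sign c ℤ.+ balance w

balance-++ : ∀ x y → balance (x ++ y) ≡ balance x ℤ.+ balance y
balance-++ []      y = sym (ℤₚ.+-identityˡ (balance y))
balance-++ (c ∷ x) y = trans (cong (λ z → sign c ℤ.+ z) (balance-++ x y)) (sym (ℤₚ.+-assoc (sign c) _ _))

balance-infix : ∀ t u v → balance (t ++ u ++ v) ≡ balance t ℤ.+ (balance u ℤ.+ balance v)
balance-infix t u v = trans (balance-++ t (u ++ v)) (cong (λ z → balance t ℤ.+ z) (balance-++ u v))

balance-infix-cong : ∀ t v {u w} → balance u ≡ balance w → balance (t ++ u ++ v) ≡ balance (t ++ w ++ v)
balance-infix-cong t v {u} {w} bu≡bw = begin
  balance (t ++ u ++ v)                  ≡⟨ balance-infix t u v ⟩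
  balance t ℤ.+ (balance u ℤ.+ balance v) ≡⟨ cong (λ z → balance t ℤ.+ (z ℤ.+ balance v)) bu≡bw ⟩
  balance t ℤ.+ (balance w ℤ.+ balance v) ≡⟨ balance-infix t w v ⟨
  balance (t ++ w ++ v)                  ∎
  where open ≡-Reasoning

balance-infix-cancel : ∀ t v {u w} → balance (t ++ u ++ v) ≡ balance (t ++ w ++ v) → balance u ≡ balance w
balance-infix-cancel t v {u} {w} eq = ∙-cancelʳ (balance v) _ _ (∙-cancelˡ (balance t) _ _
  (trans (sym (balance-infix t u v)) (trans eq (balance-infix t w v))))

sign-isNeg : ∀ c → + 1 ≡ sign c ℤ.+ + (2 * isNeg c)
sign-isNeg a = refl
sign-isNeg b = refl
sign-isNeg a̅ = refl
sign-isNeg b̅ = refl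

length-balance : ∀ w → + length w ≡ balance w ℤ.+ + (2 * negCount w)
length-balance []      = refl
length-balance (c ∷ w) = begin
  + 1 ℤ.+ + length w
    ≡⟨ cong₂ ℤ._+_ (sign-isNeg c) (length-balance w) ⟩
  (sign c ℤ.+ + (2 * isNeg c)) ℤ.+ (balance w ℤ.+ + (2 * negCount w))
    ≡⟨ interchange (sign c) _ (balance w) _ ⟩
  balance (c ∷ w) ℤ.+ + (2 * isNeg c + 2 * negCount w)
    ≡⟨ cong (λ n → balance (c ∷ w) ℤ.+ + n) (sym (*-distribˡ-+ 2 (isNeg c) (negCount w))) ⟩
  balance (c ∷ w) ℤ.+ + (2 * negCount (c ∷ w)) ∎
  where open ≡-Reasoning

balance≡⇒negCount≤⇒length≤ : ∀ u w → balance u ≡ balance w → negCount u ≤ negCount w → length u ≤ length w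
balance≡⇒negCount≤⇒length≤ u w bu≡bw nu≤nw = ℤₚ.drop‿+≤+ (begin
  + length u                              ≡⟨ length-balance u ⟩
  balance u ℤ.+ + (2 * negCount u)       ≤⟨ ℤₚ.+-monoʳ-≤ (balance u) (+≤+ (*-monoʳ-≤ 2 nu≤nw)) ⟩
  balance u ℤ.+ + (2 * negCount w)       ≡⟨ cong (λ z → z ℤ.+ + (2 * negCount w)) bu≡bw ⟩
  balance w ℤ.+ + (2 * negCount w)       ≡⟨ length-balance w ⟨
  + length w                              ∎)
  where open ℤₚ.≤-Reasoning

BalancedRule : Word × Word → Set
BalancedRule (ℓ , r) = balance ℓ ≡ balance r

Step-balance : ∀ {T x y} → All BalancedRule T → Step T x y → balance x ≡ balance y
Step-balance bal (fwd t v uw∈T) = balance-infix-cong t v (lookup bal uw∈T)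
Step-balance bal (bwd t v wu∈T) = balance-infix-cong t v (sym (lookup bal wu∈T))

Congruent-balance : ∀ {T x y} → All BalancedRule T → Congruent T x y → balance x ≡ balance y
Congruent-balance bal ε        = refl
Congruent-balance bal (s ◅ ss) = trans (Step-balance bal s) (Congruent-balance bal ss)

S-balanced : All BalancedRule S
S-balanced = refl ∷ refl ∷ refl ∷ refl ∷ refl ∷ refl ∷ refl ∷ refl ∷ refl ∷ refl ∷ refl ∷ refl ∷ []

InL-balance : ∀ {x} → InL x → balance x ≡ + 0
InL-balance λ~x = sym (Congruent-balance S-balanced λ~x)

bar : Letter → Letter
bar a = a̅
bar b = b̅
bar a̅ = a
bar b̅ = b

bar-cancel∈S : ∀ c → (bar c ∷ c ∷ [] , []) ∈ S
bar-cancel∈S a  = there (here refl)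
bar-cancel∈S b  = there (there (there (there (there (there (there (here refl)))))))
bar-cancel∈S a̅ = here refl
bar-cancel∈S b̅ = there (there (there (there (there (there (here refl))))))

inverse : Word → Word
inverse []      = []
inverse (c ∷ w) = inverse w ∷ʳ bar c

inverse-cancel : ∀ w → InL (inverse w ++ w ++ [])
inverse-cancel []      = ε
inverse-cancel (c ∷ w) = subst InL (sym (List.∷ʳ-++ (inverse w) (bar c) (c ∷ w ++ [])))
  (inverse-cancel w ◅◅ bwd (inverse w) (w ++ []) (bar-cancel∈S c) ◅ ε)

PreservesL : ThueSystem → Set
PreservesL T = ∀ {x y} → Step T x y → InL x → InL y

NegDecreasing : ThueSystem → Set
NegDecreasing T = ∀ {ℓ r} → (ℓ , r) ∈ T → length r < length ℓ → negCount r < negCount ℓ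

PreservesL⇒NegDecreasing : ∀ {T} → PreservesL T → NegDecreasing T
PreservesL⇒NegDecreasing preserves {ℓ} {r} ℓr∈T ∣r∣<∣ℓ∣ =
  ≰⇒> λ (nℓ≤nr : negCount ℓ ≤ negCount r) →
    <⇒≱ ∣r∣<∣ℓ∣ (balance≡⇒negCount≤⇒length≤ ℓ r bℓ≡br nℓ≤nr)
  where
  in-L : InL (inverse ℓ ++ ℓ ++ [])
  in-L = inverse-cancel ℓ
  bℓ≡br : balance ℓ ≡ balance r
  bℓ≡br = balance-infix-cancel (inverse ℓ) [] (trans
    (InL-balance in-L) (sym (InL-balance (preserves (fwd (inverse ℓ) [] ℓr∈T) in-L))))

data Contraction (T : ThueSystem) : Word → Word → Set where
  contract : ∀ t v {ℓ r} → (ℓ , r) ∈ T → length r < length ℓ → Contraction T (t ++ ℓ ++ v) (t ++ r ++ v)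

Reduces1⇒Contraction : ∀ {T x y} → LengthOrdered T → Reduces1 T x y → Contraction T x y
Reduces1⇒Contraction lo (fwd t v uw∈T , lt) = contract t v uw∈T (length-infix-cancel-< t v lt)
Reduces1⇒Contraction lo (bwd t v wu∈T , lt) = ⊥-elim (<⇒≱ (length-infix-cancel-< t v lt) (lo wu∈T))

module _ {T : ThueSystem} (neg↓ : NegDecreasing T) where

  Contraction-negCount : ∀ {x x′} → Contraction T x x′ → negCount x′ < negCount x
  Contraction-negCount (contract t v ℓr∈T ∣r∣<∣ℓ∣) = negCount-infix-mono-< t v (neg↓ ℓr∈T ∣r∣<∣ℓ∣)

  module _ {k : ℕ} {y : Word} (y⁺ : PositiveWord y) where

    -- A shared suffix this long survives negCount x further contractions, each eating at most Q T of it.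
    Guarded : Word → Set
    Guarded x = SharedSuffix (Q T * negCount x + k) y x

    Contraction-Guarded : ∀ {x x′} → Contraction T x x′ → Guarded x → Guarded x′
    Contraction-Guarded c@(contract t v {ℓ} {r} ℓr∈T ∣r∣<∣ℓ∣) (shared q p s y≡ x≡ long)
      with ++-overlap p s (t ++ ℓ) v (trans (sym x≡) (sym (List.++-assoc t ℓ v)))
    ... | inj₁ (e , _ , v≡) =
      shared q (t ++ r ++ e) s y≡ x′≡ (≤-trans (+-monoˡ-≤ k (*-monoʳ-≤ (Q T) (<⇒≤ (Contraction-negCount c)))) long)
      where
      x′≡ : t ++ r ++ v ≡ (t ++ r ++ e) ++ s
      x′≡ = begin
        t ++ r ++ v         ≡⟨ cong (λ z → t ++ r ++ z) v≡ ⟩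
        t ++ r ++ e ++ s    ≡⟨ cong (t ++_) (List.++-assoc r e s) ⟨
        t ++ (r ++ e) ++ s  ≡⟨ List.++-assoc t (r ++ e) s ⟨
        (t ++ r ++ e) ++ s  ∎
        where open ≡-Reasoning
    ... | inj₂ (e , tℓ≡ , s≡) with ++-overlap t ℓ p e tℓ≡
    ...   | inj₁ (e′ , _ , e≡) = ⊥-elim (n≮0 (subst (negCount r <_) (negCount-positive ℓ⁺) (neg↓ ℓr∈T ∣r∣<∣ℓ∣)))
      where
      ℓ⁺ : PositiveWord ℓ
      ℓ⁺ = ++⁻ʳ e′ (subst PositiveWord e≡ (++⁻ˡ e (subst PositiveWord s≡ (++⁻ʳ q (subst PositiveWord y≡ y⁺)))))
    ...   | inj₂ (e′ , _ , ℓ≡) =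
      shared (q ++ e) (t ++ r) v y≡′ (sym (List.++-assoc t r v))
        (shed-budget (Q T) (Contraction-negCount c) (subst (_ ≤_) ∣s∣≡ long) ∣e∣≤Q)
      where
      y≡′ : y ≡ (q ++ e) ++ v
      y≡′ = trans y≡ (trans (cong (q ++_) s≡) (sym (List.++-assoc q e v)))
      ∣s∣≡ : length s ≡ length e + length v
      ∣s∣≡ = trans (cong length s≡) (List.length-++ e)
      ∣e∣≤∣ℓ∣ : length e ≤ length ℓ
      ∣e∣≤∣ℓ∣ = subst (length e ≤_) (sym (trans (cong length ℓ≡) (List.length-++ e′))) (m≤n+m _ _)
      ∣e∣≤Q : length e ≤ Q T
      ∣e∣≤Q = ≤-trans ∣e∣≤∣ℓ∣ (foldr-⊔-bound (λ rule → length (proj₁ rule)) ℓr∈T)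

    Reduces-Guarded : ∀ {x x′} → LengthOrdered T → Reduces T x x′ → Guarded x → Guarded x′
    Reduces-Guarded lo ε          g = g
    Reduces-Guarded lo (s₁ ◅ ss) g = Reduces-Guarded lo ss (Contraction-Guarded (Reduces1⇒Contraction lo s₁) g)

ChurchRosser⇒Reduces : ∀ {T x z} → ChurchRosser T → Congruent T x z → Irreducible T z → Reduces T x z
ChurchRosser⇒Reduces cr x~z z-irr with cr _ _ x~z
... | _ , x→w , ε         = x→w
... | _ , _   , (z→z′ ◅ _) = ⊥-elim (z-irr _ z→z′)

classes⇒PreservesL : ∀ {T us} →
  (∀ x → (InL x → Any (λ u → InClass T u x) us) × (Any (λ u → InClass T u x) us → InL x)) → PreservesL T
classes⇒PreservesL classes {x} {y} x↔y x∈L =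
  proj₂ (classes y) (Any.map (_◅◅ (x↔y ◅ ε)) (proj₁ (classes x) x∈L))

mainTheorem9 : (T : ThueSystem) → LengthOrdered T → ChurchRosser T →
    (us : List Word) → All (Irreducible T) us → All InL us →
    (∀ x → (InL x → Any (λ u → InClass T u x) us) × (Any (λ u → InClass T u x) us → InL x)) →
    (k : ℕ) → 1 ≤ k → (y : Word) → PositiveWord y → length y ≡ Q T * R us + k →
    (u : Word) → u ∈ us →
    (z : Word) → InClass T (u ++ y) z → Irreducible T z →
    AgreeRight k y z
mainTheorem9 T lo cr us _ _ classes k _ y y⁺ ∣y∣≡ u u∈us z u++y~z z-irr =
  SharedSuffix⇒AgreeRight (SharedSuffix-weaken (m≤n+m k _)
    (Reduces-Guarded neg↓ y⁺ lo (ChurchRosser⇒Reduces cr u++y~z z-irr) (shared [] u y refl refl y-long)))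
  where
  neg↓ : NegDecreasing T
  neg↓ = PreservesL⇒NegDecreasing (classes⇒PreservesL classes)
  y-long : Q T * negCount (u ++ y) + k ≤ length y
  y-long = begin
    Q T * negCount (u ++ y) + k          ≡⟨ cong (λ n → Q T * n + k) (negCount-++ u y) ⟩
    Q T * (negCount u + negCount y) + k  ≡⟨ cong (λ n → Q T * (negCount u + n) + k) (negCount-positive y⁺) ⟩
    Q T * (negCount u + 0) + k           ≡⟨ cong (λ n → Q T * n + k) (+-identityʳ (negCount u)) ⟩
    Q T * negCount u + k                 ≤⟨ +-monoˡ-≤ k (*-monoʳ-≤ (Q T) (foldr-⊔-bound negCount u∈us)) ⟩
    Q T * R us + k                       ≡⟨ ∣y∣≡ ⟨
    length y                             ∎
    where open ≤-Reasoning
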